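{- Let $k\ge1$ and $b_0,b_1,\dots,b_k$ be nonnegative integers such that the semistar $K_{b_0}(b_1,\dots,b_k)$ is recursively partitionable, and let $G_0,G_1,\dots,G_k$ be recursively partitionable graphs with $n(G_i)=b_i$ for each $i$ (where, if $b_i=0$, $G_i$ is the graph with no vertices). Then the graph \[H=G_0+\left(\bigcup_{i=1}^k G_i\right)\] is recursively partitionable.
   Context: $n(G)$ is the number of vertices of $G$. For graphs $X,Y$, $X+Y$ denotes the join: the disjoint union of $X$ and $Y$ together with all edges between a vertex of $X$ and a vertex of $Y$; $\bigcup$ denotes disjoint union. The semistar $K_{b_0}(b_1,\dots,b_k)$ is $K_{b_0}+\left(\bigcup_{i=1}^k K_{b_i}\right)$, with $K_0$ the graph with no vertices. A graph $G$ on $n$ vertices is recursively partitionable (RP) if $G\simeq K_1$, or $G$ is connected and for every integer partition $a_1,\dots,a_m$ of $n$ there is a partition $\{A_1,\dots,A_m\}$ of $V(G)$ with $|A_i|=a_i$ such that each induced subgraph $G[A_i]$ is RP. -}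

module Defs where

open import Data.Nat using (ℕ; zero; suc; _+_; _≤_)
open import Data.Fin using (Fin; zero; suc; splitAt)
open import Data.Sum using (_⊎_; inj₁; inj₂)
open import Data.Product using (Σ; Σ-syntax; _,_)
open import Data.Empty using (⊥)
open import Data.Unit using (⊤)
open import Relation.Nullary using (¬_)
open import Relation.Binary.PropositionalEquality using (_≡_; _≢_; refl; sym)
open import Function.Bundles using (_↔_; Inverse)

record Graph (n : ℕ) : Set₁ where
  field
    Adj    : Fin n → Fin n → Set
    adj-sym    : ∀ {x y} → Adj x y → Adj y x
    adj-irrefl : ∀ {x} → ¬ Adj x x
open Graph public

K : (n : ℕ) → Graph n
K n = record { Adj = λ x y → x ≢ y ; adj-sym = λ p q → p (sym q) ; adj-irrefl = λ p → p refl }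

-- Edges on Fin m ⊎ Fin n: inside the first / second graph, and between them
-- all pairs (cross = ⊤, join) or none (cross = ⊥, disjoint union).
sumAdj : ∀ {m n} → Set → Graph m → Graph n → Fin m ⊎ Fin n → Fin m ⊎ Fin n → Set
sumAdj c G H (inj₁ x) (inj₁ y) = Adj G x y
sumAdj c G H (inj₂ x) (inj₂ y) = Adj H x y
sumAdj c G H (inj₁ x) (inj₂ y) = c
sumAdj c G H (inj₂ x) (inj₁ y) = c

sumAdj-sym : ∀ {m n} c (G : Graph m) (H : Graph n) u v → sumAdj c G H u v → sumAdj c G H v u
sumAdj-sym c G H (inj₁ x) (inj₁ y) p = adj-sym G p
sumAdj-sym c G H (inj₂ x) (inj₂ y) p = adj-sym H p
sumAdj-sym c G H (inj₁ x) (inj₂ y) p = p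
sumAdj-sym c G H (inj₂ x) (inj₁ y) p = p

sumAdj-irrefl : ∀ {m n} c (G : Graph m) (H : Graph n) u → ¬ sumAdj c G H u u
sumAdj-irrefl c G H (inj₁ x) = adj-irrefl G
sumAdj-irrefl c G H (inj₂ x) = adj-irrefl H

sumGraph : ∀ {m n} → Set → Graph m → Graph n → Graph (m + n)
sumGraph {m} c G H = record
  { Adj    = λ x y → sumAdj c G H (splitAt m x) (splitAt m y)
  ; adj-sym    = λ {x} {y} → sumAdj-sym c G H (splitAt m x) (splitAt m y)
  ; adj-irrefl = λ {x} → sumAdj-irrefl c G H (splitAt m x)
  }

_∪_ : ∀ {m n} → Graph m → Graph n → Graph (m + n)
_∪_ = sumGraph ⊥

_⊕_ : ∀ {m n} → Graph m → Graph n → Graph (m + n)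
_⊕_ = sumGraph ⊤

sumF : ∀ {k} → (Fin k → ℕ) → ℕ
sumF {zero}  b = 0
sumF {suc k} b = b zero + sumF (λ i → b (suc i))

⋃ : ∀ {k} (b : Fin k → ℕ) → ((i : Fin k) → Graph (b i)) → Graph (sumF b)
⋃ {zero}  b G = K 0
⋃ {suc k} b G = G zero ∪ ⋃ (λ i → b (suc i)) (λ i → G (suc i))

Semistar : ∀ {k} (b₀ : ℕ) (b : Fin k → ℕ) → Graph (b₀ + sumF b)
Semistar b₀ b = K b₀ ⊕ ⋃ b (λ i → K (b i))

induced : ∀ {n a} → Graph n → (Fin a → Fin n) → Graph a
induced G e = record { Adj = λ x y → Adj G (e x) (e y) ; adj-sym = adj-sym G ; adj-irrefl = adj-irrefl G }

data Walk {n} (G : Graph n) : Fin n → Fin n → Set where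
  here : ∀ {x} → Walk G x x
  step : ∀ {x y z} → Adj G x y → Walk G y z → Walk G x z

Connected : ∀ {n} → Graph n → Set
Connected {n} G = ∀ (x y : Fin n) → Walk G x y

-- A partition of V(G) = Fin n into parts A_i of sizes a i (i : Fin m) is a
-- bijection  Σ i. Fin (a i)  ↔  Fin n ; part i is enumerated by  j ↦ to (i , j).
part : ∀ {m n} {a : Fin m → ℕ} → (Σ (Fin m) (λ i → Fin (a i)) ↔ Fin n) → (i : Fin m) → Fin (a i) → Fin n
part φ i j = Inverse.to φ (i , j)

-- Recursively partitionable graphs.  A graph on one vertex is K_1.
-- The trivial partition (m = 1) is vacuous, so only m ≥ 2 is required.
data RP : ∀ {n} → Graph n → Set₁ where
  rp-K1  : (G : Graph 1) → RP G
  rp-rec : ∀ {n} (G : Graph n) → Connected G →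
           (∀ (m : ℕ) (a : Fin m → ℕ) → (∀ i → 1 ≤ a i) → sumF a ≡ n → 2 ≤ m →
              Σ[ φ ∈ (Σ (Fin m) (λ i → Fin (a i)) ↔ Fin n) ]
                ((i : Fin m) → RP (induced G (part φ i)))) →
           RP G

-- The semistar S = K_{b₀}(b₁,…,b_k) and H = G₀ + ⋃ Gᵢ share the vertex classes V₀,…,V_k
-- (|Vᵢ| = bᵢ), and H arises from S by replacing the clique on each class by an RP graph.
-- Given sizes a₁,…,a_m, partition S into RP parts S_j and let t_{j,c} be the number of
-- vertices of class c in S_j.  Each class of H induces an RP graph on Σ_j t_{j,c} vertices,
-- so it splits into RP pieces of sizes t_{j,c}; collecting the j-th pieces of all classes
-- gives a part H_j of size a_j.  H_j stands to S_j as H stands to S: its classes are RP,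
-- and each edge of S_j between classes c ≠ d is matched by all c–d edges of H_j.  Hence
-- H_j is RP by induction on the derivation of RP S.  Only this class-level relation R
-- (for the semistar: one of c, d is the centre class) enters the induction.

module Submission where

open import Defs
open import Data.Nat using (ℕ; zero; suc; _+_; _≤_; z≤n; s≤s)
open import Data.Nat.Properties using (m+n≡0⇒m≡0; +-identityʳ; m+1+n≢0; suc-injective)
open import Data.Fin using (Fin; zero; suc; splitAt)
open import Data.Fin.Properties using (+↔⊎; splitAt-↑ˡ; splitAt-↑ʳ; _≟_)
open import Data.Fin.Permutation using (↔⇒≡)
open import Data.Vec.Functional using ([]; _∷_)
open import Data.Product using (Σ; Σ-syntax; ∃; _,_; proj₁; proj₂; _×_)
open import Data.Product.Algebra using (Σ-assoc-alt)
open import Data.Product.Function.Dependent.Propositional using (Σ-↔)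
open import Data.Sum using (_⊎_; inj₁; inj₂; [_,_]′)
open import Data.Sum.Algebra using (⊎-comm)
open import Data.Sum.Function.Propositional using (_⊎-cong_)
open import Data.Empty using (⊥; ⊥-elim)
open import Data.Unit using (⊤; tt)
open import Function using (_∘_; id; case_of_)
open import Function.Bundles using (_↔_; Inverse; mk↔ₛ′)
open import Function.Properties.Inverse using (↔-refl; ↔-sym; ↔-trans)
open import Relation.Nullary using (Dec; yes; no; Irrelevant)
open import Relation.Binary.PropositionalEquality
open import Axiom.UniquenessOfIdentityProofs using (module Decidable⇒UIP)

open Inverse using (to; from; strictlyInverseˡ; strictlyInverseʳ)

Σ-congʳ : {I : Set} {A B : I → Set} → (∀ i → A i ↔ B i) → Σ I A ↔ Σ I B
Σ-congʳ f = mk↔ₛ′ (λ (i , x) → i , to (f i) x) (λ (i , y) → i , from (f i) y)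
  (λ (i , y) → cong (i ,_) (strictlyInverseˡ (f i) y))
  (λ (i , x) → cong (i ,_) (strictlyInverseʳ (f i) x))

Σ-swap : {I J : Set} {C : I → J → Set} →
         Σ I (λ i → Σ J (C i)) ↔ Σ J (λ j → Σ I (λ i → C i j))
Σ-swap = mk↔ₛ′ (λ (i , j , x) → j , i , x) (λ (j , i , x) → i , j , x) (λ _ → refl) (λ _ → refl)

Σ-fibres↔ : {A I : Set} (f : A → I) → Σ I (λ i → Σ A (λ x → f x ≡ i)) ↔ A
Σ-fibres↔ f = mk↔ₛ′ (proj₁ ∘ proj₂) (λ x → f x , x , refl) (λ _ → refl) λ { (_ , _ , refl) → refl }

fibre-proj₁↔ : {I : Set} {B : I → Set} (i : I) → Σ (Σ I B) (λ p → proj₁ p ≡ i) ↔ B i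
fibre-proj₁↔ i = mk↔ₛ′ (λ { ((_ , x) , refl) → x }) (λ x → (i , x) , refl)
  (λ _ → refl) λ { ((_ , _) , refl) → refl }

⊎↔Σ-Fin2 : {A : Fin 2 → Set} → (A zero ⊎ A (suc zero)) ↔ Σ (Fin 2) A
⊎↔Σ-Fin2 = mk↔ₛ′ [ (zero ,_) , (suc zero ,_) ]′
  (λ { (zero , x) → inj₁ x ; (suc zero , y) → inj₂ y })
  (λ { (zero , _) → refl ; (suc zero , _) → refl })
  (λ { (inj₁ _) → refl ; (inj₂ _) → refl })

Σ-Fin-suc↔ : ∀ {m} {A : Fin (suc m) → Set} → Σ (Fin (suc m)) A ↔ (A zero ⊎ Σ (Fin m) (A ∘ suc))
Σ-Fin-suc↔ = mk↔ₛ′ (λ { (zero , x) → inj₁ x ; (suc i , x) → inj₂ (i , x) })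
  [ (zero ,_) , (λ (i , x) → suc i , x) ]′
  (λ { (inj₁ _) → refl ; (inj₂ _) → refl })
  (λ { (zero , _) → refl ; (suc _ , _) → refl })

Σ-Fin↔sumF : ∀ {m} (u : Fin m → ℕ) → Σ (Fin m) (λ i → Fin (u i)) ↔ Fin (sumF u)
Σ-Fin↔sumF {zero}  u = mk↔ₛ′ (λ ()) (λ ()) (λ ()) (λ ())
Σ-Fin↔sumF {suc m} u = ↔-trans Σ-Fin-suc↔ (↔-trans (↔-refl ⊎-cong Σ-Fin↔sumF (u ∘ suc)) (↔-sym +↔⊎))

Dec⇒Fin↔ : {P : Set} → Dec P → Irrelevant P → ∃ λ c → Fin c ↔ P
Dec⇒Fin↔ (yes p) irr = 1 , mk↔ₛ′ (λ _ → p) (λ _ → zero) (irr p) λ { zero → refl }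
Dec⇒Fin↔ (no ¬p) _   = 0 , mk↔ₛ′ (λ ()) (⊥-elim ∘ ¬p) (⊥-elim ∘ ¬p) (λ ())

Fin↔Σ-Dec : ∀ {a} {P : Fin a → Set} → (∀ x → Dec (P x)) → (∀ x → Irrelevant (P x)) →
            ∃ λ c → Fin c ↔ Σ (Fin a) P
Fin↔Σ-Dec {zero}  _  _   = 0 , mk↔ₛ′ (λ ()) (λ ()) (λ ()) (λ ())
Fin↔Σ-Dec {suc a} P? irr =
  let c₀ , e₀ = Dec⇒Fin↔ (P? zero) (irr zero)
      c  , e  = Fin↔Σ-Dec (P? ∘ suc) (irr ∘ suc)
  in c₀ + c , ↔-trans +↔⊎ (↔-trans (e₀ ⊎-cong e) (↔-sym Σ-Fin-suc↔))

sumF-count : ∀ {m n} {a t : Fin m → ℕ} (ψ : Σ (Fin m) (λ i → Fin (a i)) ↔ Fin n) (P : Fin n → Set) →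
             (∀ j → Fin (t j) ↔ Σ (Fin (a j)) (P ∘ part ψ j)) → Fin (sumF t) ↔ Σ (Fin n) P
sumF-count ψ P count = ↔-trans (↔-sym (Σ-Fin↔sumF _))
  (↔-trans (Σ-congʳ count) (↔-trans (↔-sym Σ-assoc-alt) (Σ-↔ ψ ↔-refl)))

classOf : ∀ {K n} {s : Fin K → ℕ} → (Σ (Fin K) (λ i → Fin (s i)) ↔ Fin n) → Fin n → Fin K
classOf φ = proj₁ ∘ from φ

classOf-part : ∀ {K n} {s : Fin K → ℕ} (φ : Σ (Fin K) (λ i → Fin (s i)) ↔ Fin n) c r →
               classOf φ (part φ c r) ≡ c
classOf-part φ c r = cong proj₁ (strictlyInverseʳ φ (c , r))

Fin↔class : ∀ {K n} {s : Fin K → ℕ} (φ : Σ (Fin K) (λ i → Fin (s i)) ↔ Fin n) c →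
            Fin (s c) ↔ Σ (Fin n) (λ x → classOf φ x ≡ c)
Fin↔class φ c = ↔-trans (↔-sym (fibre-proj₁↔ c)) (↔-sym (Σ-↔ (↔-sym φ) ↔-refl))

module FibrePartition {K a : ℕ} (f : Fin a → Fin K) where

  fibre : ∀ c → ∃ λ size → Fin size ↔ Σ (Fin a) (λ y → f y ≡ c)
  fibre c = Fin↔Σ-Dec (λ y → f y ≟ c) (λ y → Decidable⇒UIP.≡-irrelevant _≟_)

  size : Fin K → ℕ
  size = proj₁ ∘ fibre

  partition : Σ (Fin K) (λ i → Fin (size i)) ↔ Fin a
  partition = ↔-trans (Σ-congʳ (proj₂ ∘ fibre)) (Σ-fibres↔ f)

module Refinement {K m n : ℕ} {s : Fin K → ℕ} {a : Fin m → ℕ} {t : Fin m → Fin K → ℕ}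
  (φ : Σ (Fin K) (λ i → Fin (s i)) ↔ Fin n)
  (φ′ : ∀ j → Σ (Fin K) (λ i → Fin (t j i)) ↔ Fin (a j))
  (π : ∀ c → Σ (Fin m) (λ j → Fin (t j c)) ↔ Fin (s c)) where

  -- Opaque so that the typechecker compares parts of χ through part-χ instead of unfolding χ.
  opaque
    χ : Σ (Fin m) (λ i → Fin (a i)) ↔ Fin n
    χ = ↔-trans (Σ-congʳ (↔-sym ∘ φ′)) (↔-trans Σ-swap (↔-trans (Σ-congʳ π) φ))

    part-χ : ∀ j c r → part χ j (part (φ′ j) c r) ≡ part φ c (part (π c) j r)
    part-χ j c r = cong (λ (c , r) → part φ c (part (π c) j r)) (strictlyInverseʳ (φ′ j) (c , r))

    classOf-χ : ∀ j y → classOf φ (part χ j y) ≡ classOf (φ′ j) y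
    classOf-χ j y = classOf-part φ _ _

_++ʷ_ : ∀ {n} {G : Graph n} {x y z} → Walk G x y → Walk G y z → Walk G x z
here     ++ʷ w = w
step a v ++ʷ w = step a (v ++ʷ w)

walk-map : ∀ {n n′} {G : Graph n} {G′ : Graph n′} (f : Fin n → Fin n′) →
           (∀ {x y} → Adj G x y → Walk G′ (f x) (f y)) →
           ∀ {x y} → Walk G x y → Walk G′ (f x) (f y)
walk-map f edge here       = here
walk-map f edge (step a w) = edge a ++ʷ walk-map f edge w

edge-walk : ∀ {n} {G : Graph n} {x y} → Adj G x y → Walk G x y
edge-walk a = step a here

RP-connected : ∀ {n} {G : Graph n} → RP G → Connected G
RP-connected (rp-K1 _) zero zero = here
RP-connected (rp-rec _ conn _)   = conn

RP-empty : (G : Graph 0) → RP G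
RP-empty G = rp-rec G (λ ()) λ
  { zero    _ _   _   ()
  ; (suc _) a pos sum _ → case subst (1 ≤_) (m+n≡0⇒m≡0 (a zero) sum) (pos zero) of λ () }

RP-⊆ : ∀ {n} {G G′ : Graph n} → RP G → (∀ {x y} → Adj G x y → Adj G′ x y) → RP G′
RP-⊆ {G′ = G′} (rp-K1 _) _ = rp-K1 G′
RP-⊆ {G′ = G′} (rp-rec _ conn parts) G⊆G′ = rp-rec G′
  (λ x y → walk-map id (edge-walk ∘ G⊆G′) (conn x y))
  (λ m a pos sum m≥2 →
     let φ , rps = parts m a pos sum m≥2 in φ , λ i → RP-⊆ (rps i) G⊆G′)

RP-≗ : ∀ {n k} {G : Graph n} {e e′ : Fin k → Fin n} →
       (∀ x → e x ≡ e′ x) → RP (induced G e) → RP (induced G e′)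
RP-≗ {G = G} e≗e′ rp = RP-⊆ rp (subst₂ (Adj G) (e≗e′ _) (e≗e′ _))

RP-Bipartition : ∀ {n} → Graph n → ℕ → ℕ → Set₁
RP-Bipartition {n} G a b =
  Σ[ ψ ∈ ((Fin a ⊎ Fin b) ↔ Fin n) ] RP (induced G (to ψ ∘ inj₁)) × RP (induced G (to ψ ∘ inj₂))

RP-split-0+ : ∀ {n b} {G : Graph n} → RP G → b ≡ n → RP-Bipartition G 0 b
RP-split-0+ rp refl = ↔-sym +↔⊎ , RP-empty _ , rp

RP-split₂ : ∀ {n} {G : Graph n} a b → RP G → a + b ≡ n → RP-Bipartition G a b
RP-split₂ zero    b    rp b≡n   = RP-split-0+ rp b≡n
RP-split₂ (suc a) zero rp a+0≡n =
  let ψ , rp₁ , rp₂ = RP-split-0+ rp (trans (sym (+-identityʳ _)) a+0≡n)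
  in ↔-trans (⊎-comm _ _) ψ , rp₂ , rp₁
RP-split₂ (suc a) (suc b) (rp-K1 _) a+b≡1 = ⊥-elim (m+1+n≢0 a (suc-injective a+b≡1))
RP-split₂ (suc a) (suc b) (rp-rec _ _ parts) a+b≡n =
  let ψ , rps = parts 2 (suc a ∷ suc b ∷ []) (λ { zero → s≤s z≤n ; (suc zero) → s≤s z≤n })
                  (trans (cong (suc a +_) (+-identityʳ _)) a+b≡n) (s≤s (s≤s z≤n))
  in ↔-trans ⊎↔Σ-Fin2 ψ , rps zero , rps (suc zero)

RP-partition : ∀ {n} {G : Graph n} → RP G → ∀ {m} (t : Fin m → ℕ) → sumF t ≡ n →
               Σ[ π ∈ (Σ (Fin m) (λ i → Fin (t i)) ↔ Fin n) ] (∀ j → RP (induced G (part π j)))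
RP-partition rp {zero}  t refl = Σ-Fin↔sumF t , λ ()
RP-partition rp {suc m} t sum≡n =
  let ψ , rp₁ , rp₂ = RP-split₂ (t zero) (sumF (t ∘ suc)) rp sum≡n
      π , rps       = RP-partition rp₂ (t ∘ suc) refl
  in ↔-trans Σ-Fin-suc↔ (↔-trans (↔-refl ⊎-cong π) ψ) , λ { zero → rp₁ ; (suc j) → rps j }

blowup-connected : ∀ {K n} {S H : Graph n} {s : Fin K → ℕ} → Connected S →
  (φ : Σ (Fin K) (λ i → Fin (s i)) ↔ Fin n) → (∀ c → Connected (induced H (part φ c))) →
  (∀ {x y} → Adj S x y → classOf φ x ≢ classOf φ y → Adj H x y) → Connected H
blowup-connected {S = S} {H} connS φ connClass cross x y = walk-map id edge (connS x y)
  where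
  within-class : ∀ p q → proj₁ p ≡ proj₁ q → Walk H (to φ p) (to φ q)
  within-class (c , r) (.c , r′) refl = walk-map (part φ c) edge-walk (connClass c r r′)

  edge : ∀ {x y} → Adj S x y → Walk H x y
  edge {x} {y} a with classOf φ x ≟ classOf φ y
  ... | yes same = subst₂ (Walk H) (strictlyInverseˡ φ x) (strictlyInverseˡ φ y)
                          (within-class (from φ x) (from φ y) same)
  ... | no  diff = edge-walk (cross a diff)

CrossEdges⊆ : ∀ {K n} → (Fin K → Fin K → Set) → Graph n → (Fin n → Fin K) → Set
CrossEdges⊆ R S col = ∀ x y → Adj S x y → col x ≢ col y → R (col x) (col y)

CrossEdges⊇ : ∀ {K n} → (Fin K → Fin K → Set) → Graph n → (Fin n → Fin K) → Set
CrossEdges⊇ R H col = ∀ x y → col x ≢ col y → R (col x) (col y) → Adj H x y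

CrossEdges⊇-≗ : ∀ {K n} (R : Fin K → Fin K → Set) {H : Graph n} {col col′ : Fin n → Fin K} →
                (∀ x → col x ≡ col′ x) → CrossEdges⊇ R H col → CrossEdges⊇ R H col′
CrossEdges⊇-≗ R col≗ H⊇ x y diff r = H⊇ x y
  (λ same → diff (trans (sym (col≗ x)) (trans same (col≗ y))))
  (subst₂ R (sym (col≗ x)) (sym (col≗ y)) r)

RP-blowup : ∀ {K n} (R : Fin K → Fin K → Set) {S : Graph n} → RP S →
  (H : Graph n) {s : Fin K → ℕ} (φ : Σ (Fin K) (λ i → Fin (s i)) ↔ Fin n) →
  CrossEdges⊆ R S (classOf φ) → CrossEdges⊇ R H (classOf φ) →
  (∀ c → RP (induced H (part φ c))) → RP H
RP-blowup R (rp-K1 _) H _ _ _ _ = rp-K1 H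
RP-blowup {K} {n} R (rp-rec S connS partsS) H {s} φ S⊆ H⊇ classes = rp-rec H
  (blowup-connected connS φ (RP-connected ∘ classes) λ a diff → H⊇ _ _ diff (S⊆ _ _ a diff))
  parts
  where
  parts : ∀ m (a : Fin m → ℕ) → (∀ i → 1 ≤ a i) → sumF a ≡ n → 2 ≤ m →
          Σ[ χ ∈ (Σ (Fin m) (λ i → Fin (a i)) ↔ Fin n) ] (∀ j → RP (induced H (part χ j)))
  parts m a pos sum m≥2 = χ , λ j →
    RP-blowup R (proj₂ (partsS m a pos sum m≥2) j) (induced H (part χ j)) (φ′ j)
      -- classOf (φ′ j) is classOf φ ∘ part ψ j by construction
      (λ y y′ → S⊆ (part ψ j y) (part ψ j y′))
      (CrossEdges⊇-≗ R {H = induced H (part χ j)} (classOf-χ j)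
                     (λ y y′ → H⊇ (part χ j y) (part χ j y′)))
      (λ c → RP-≗ {G = H} (sym ∘ part-χ j c) (rpπ c j))
    where
    ψ : Σ (Fin m) (λ i → Fin (a i)) ↔ Fin n
    ψ = proj₁ (partsS m a pos sum m≥2)

    module F j = FibrePartition (classOf φ ∘ part ψ j)

    φ′ : ∀ j → Σ (Fin K) (λ i → Fin (F.size j i)) ↔ Fin (a j)
    φ′ = F.partition

    class-size : ∀ c → sumF (λ j → F.size j c) ≡ s c
    class-size c = ↔⇒≡ (↔-trans (sumF-count ψ (λ x → classOf φ x ≡ c) (λ j → proj₂ (F.fibre j c)))
                                (↔-sym (Fin↔class φ c)))

    split-class : ∀ c → Σ[ π ∈ (Σ (Fin m) (λ j → Fin (F.size j c)) ↔ Fin (s c)) ]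
                          (∀ j → RP (induced (induced H (part φ c)) (part π j)))
    split-class c = RP-partition (classes c) (λ j → F.size j c) (class-size c)

    π : ∀ c → Σ (Fin m) (λ j → Fin (F.size j c)) ↔ Fin (s c)
    π = proj₁ ∘ split-class

    rpπ : ∀ c j → RP (induced (induced H (part φ c)) (part (π c) j))
    rpπ = proj₂ ∘ split-class

    open Refinement φ φ′ π

⋃-edge-within : ∀ {k} (b : Fin k → ℕ) (G : ∀ i → Graph (b i)) {x y} → Adj (⋃ b G) x y →
                classOf (Σ-Fin↔sumF b) x ≡ classOf (Σ-Fin↔sumF b) y
⋃-edge-within {suc k} b G {x} {y} adj with splitAt (b zero) x | splitAt (b zero) y
... | inj₁ _ | inj₁ _ = refl
... | inj₂ _ | inj₂ _ = cong suc (⋃-edge-within (λ i → b (suc i)) (λ i → G (suc i)) adj)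

⋃-part-edge : ∀ {k} (b : Fin k → ℕ) (G : ∀ i → Graph (b i)) i {x y} → Adj (G i) x y →
              Adj (⋃ b G) (part (Σ-Fin↔sumF b) i x) (part (Σ-Fin↔sumF b) i y)
⋃-part-edge {suc k} b G zero adj =
  subst₂ (sumAdj ⊥ (G zero) (⋃ (λ i → b (suc i)) (λ i → G (suc i))))
    (sym (splitAt-↑ˡ (b zero) _ _)) (sym (splitAt-↑ˡ (b zero) _ _)) adj
⋃-part-edge {suc k} b G (suc i) adj =
  subst₂ (sumAdj ⊥ (G zero) (⋃ (λ i → b (suc i)) (λ i → G (suc i))))
    (sym (splitAt-↑ʳ (b zero) _ _)) (sym (splitAt-↑ʳ (b zero) _ _))
    (⋃-part-edge (λ i → b (suc i)) (λ i → G (suc i)) i adj)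

Star : ∀ {k} → Fin (suc k) → Fin (suc k) → Set
Star c d = c ≡ zero ⊎ d ≡ zero

module _ {k b₀} {b : Fin k → ℕ} (X : Graph b₀) (Y : ∀ i → Graph (b i)) where

  ⊕⋃-cross-edges⊆Star : CrossEdges⊆ Star (X ⊕ ⋃ b Y) (classOf (Σ-Fin↔sumF (b₀ ∷ b)))
  ⊕⋃-cross-edges⊆Star x y adj diff with splitAt b₀ x | splitAt b₀ y
  ... | inj₁ _ | _      = inj₁ refl
  ... | inj₂ _ | inj₁ _ = inj₂ refl
  ... | inj₂ _ | inj₂ _ = ⊥-elim (diff (cong suc (⋃-edge-within b Y adj)))

  ⊕⋃-cross-edges⊇Star : CrossEdges⊇ Star (X ⊕ ⋃ b Y) (classOf (Σ-Fin↔sumF (b₀ ∷ b)))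
  ⊕⋃-cross-edges⊇Star x y diff star with splitAt b₀ x | splitAt b₀ y | star
  ... | inj₁ _ | inj₁ _ | _ = ⊥-elim (diff refl)
  ... | inj₁ _ | inj₂ _ | _ = tt
  ... | inj₂ _ | inj₁ _ | _ = tt
  ... | inj₂ _ | inj₂ _ | inj₁ ()
  ... | inj₂ _ | inj₂ _ | inj₂ ()

  ⊕⋃-classes : RP X → (∀ i → RP (Y i)) →
               ∀ c → RP (induced (X ⊕ ⋃ b Y) (part (Σ-Fin↔sumF (b₀ ∷ b)) c))
  ⊕⋃-classes rpX _ zero = RP-⊆ rpX λ {x} {y} adj →
    subst₂ (sumAdj ⊤ X (⋃ b Y)) (sym (splitAt-↑ˡ b₀ x _)) (sym (splitAt-↑ˡ b₀ y _)) adj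
  ⊕⋃-classes _ rpY (suc i) = RP-⊆ (rpY i) λ adj →
    subst₂ (sumAdj ⊤ X (⋃ b Y)) (sym (splitAt-↑ʳ b₀ _ _)) (sym (splitAt-↑ʳ b₀ _ _))
      (⋃-part-edge b Y i adj)

theorem19 : (k : ℕ) → 1 ≤ k → (b₀ : ℕ) (b : Fin k → ℕ) →
    RP (Semistar b₀ b) →
    (G₀ : Graph b₀) (G : (i : Fin k) → Graph (b i)) →
    RP G₀ → ((i : Fin k) → RP (G i)) →
    RP (G₀ ⊕ ⋃ b G)
theorem19 k _ b₀ b rpS G₀ G rp₀ rpG =
  RP-blowup Star rpS (G₀ ⊕ ⋃ b G) (Σ-Fin↔sumF (b₀ ∷ b))
    (⊕⋃-cross-edges⊆Star (K b₀) (λ i → K (b i)))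
    (⊕⋃-cross-edges⊇Star G₀ G)
    (⊕⋃-classes G₀ G rp₀ rpG)
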